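{- Let $n\ge 0$ and $m>3$ be integers, and let $x=(n+1)F_m+F_{m-1}\lfloor n/\phi\rfloor$. Then $\mathrm{sh}_F(x)=(n+1)F_{m+1}+F_m\lfloor n/\phi\rfloor$.
   Context: $F_i$ are the Fibonacci numbers ($F_0=0,F_1=1,F_{m+1}=F_m+F_{m-1}$), $\phi=(1+\sqrt5)/2$. Every positive integer $x$ has a unique Zeckendorf representation $x=\sum_{i\in S}F_i$ with all indices $i\ge2$ and no two consecutive; the Zeckendorf shift is $\mathrm{sh}_F(x)=\sum_{i\in S}F_{i+1}$, with $\mathrm{sh}_F(0)=0$. -}

module Defs where

open import Data.Nat using (ℕ; zero; suc; _+_; _*_; _∸_; _≤_; _<_)
open import Data.List using (List; []; _∷_; map)
open import Data.Nat.ListAction using (sum)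
open import Relation.Binary.PropositionalEquality using (_≡_)
open import Data.Product using (_×_)
open import Relation.Nullary using (¬_)

F : ℕ → ℕ
F zero = 0
F (suc zero) = 1
F (suc (suc m)) = F (suc m) + F m

-- A finite set S of indices, listed in strictly decreasing order, such that
-- all indices are ≥ 2 and no two are consecutive (Zeckendorf index sets).
data ZeckSet : List ℕ → Set where
  nil  : ZeckSet []
  one  : ∀ {i} → 2 ≤ i → ZeckSet (i ∷ [])
  cons : ∀ {i j is} → suc j < i → ZeckSet (j ∷ is) → ZeckSet (i ∷ j ∷ is)

IsZeckendorf : List ℕ → ℕ → Set
IsZeckendorf S x = ZeckSet S × sum (map F S) ≡ x

shiftSum : List ℕ → ℕ
shiftSum S = sum (map (λ i → F (suc i)) S)

-- k · φ ≤ n, where φ = (1+√5)/2.  Since k φ ≤ n ⇔ k √5 ≤ 2n − k,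
-- this holds iff k ≤ 2n and 5 k² ≤ (2n − k)².
_φ≤_ : ℕ → ℕ → Set
k φ≤ n = (k ≤ 2 * n) × (5 * (k * k) ≤ (2 * n ∸ k) * (2 * n ∸ k))

-- k = ⌊ n / φ ⌋  ⇔  k φ ≤ n < (k+1) φ
IsFloorDivφ : ℕ → ℕ → Set
IsFloorDivφ n k = (k φ≤ n) × ¬ (suc k φ≤ n)

-- Fix a large M and measure a candidate y for sh(x) by its defect |y·F(M) − x·F(M+1)|.
-- By d'Ocagne's identity F(i+1)F(M) − F(i)F(M+1) = ±F(M−i), the shift of a Zeckendorf sum
-- x = Σ_{i∈S} F(i) has defect at most Σ_{i∈S} F(M−i) < F(M−1).  The claimed value
-- T = (n+1)F(m+1) + F(m)k and x are consecutive terms of a solution G of the Fibonacci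
-- recurrence; the Casoratian G(j+1)F(j+K) − G(j)F(j+K+1) only changes sign with j, so
-- T has defect |k F(K+1) − (n+1) F(K)|, where K = M − m.
-- For even K, Cassini's identity puts F(K+1)/F(K) just above φ, and kφ ≤ n < (k+1)φ bounds
-- this by F(K+2) ≤ F(M−2).  As F(M−1) + F(M−2) = F(M), the multiples sh(x)·F(M) and T·F(M)
-- are closer than F(M), hence equal.
module Submission where

open import Defs
open import Data.Nat
  using (ℕ; zero; suc; _+_; _*_; _∸_; _≤_; _<_; z≤n; s≤s; z<s; ∣_-_∣; NonZero; >-nonZero)
open import Data.Nat.Properties
open import Data.Nat.Tactic.RingSolver using (solve-∀)
open import Data.Nat.ListAction using (sum)
open import Data.List using (List; []; _∷_; map)
open import Data.List.Relation.Unary.All as All using (All; []; _∷_)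
open import Data.Product using (_,_)
open import Data.Sum using (inj₁; inj₂)
open import Relation.Nullary using (¬_)
open import Relation.Binary.PropositionalEquality
  using (_≡_; refl; sym; trans; cong; cong₂; subst; subst₂; module ≡-Reasoning)

F-≤-suc : ∀ n → F n ≤ F (suc n)
F-≤-suc zero    = z≤n
F-≤-suc (suc n) = m≤m+n (F (suc n)) (F n)

F-mono : ∀ {m n} → m ≤ n → F m ≤ F n
F-mono {n = zero} z≤n = ≤-refl
F-mono {m} {suc n} m≤1+n with m≤n⇒m<n∨m≡n m≤1+n
... | inj₁ (s≤s m≤n) = ≤-trans (F-mono m≤n) (F-≤-suc n)
... | inj₂ refl      = ≤-refl

F-pos : ∀ n → 0 < F (suc n)
F-pos zero    = z<s
F-pos (suc n) = ≤-trans (F-pos n) (m≤m+n (F (suc n)) (F n))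

n<F[2+n] : ∀ n → n < F (2 + n)
n<F[2+n] zero    = z<s
n<F[2+n] (suc n) =
  subst (suc n <_) (+-comm (F (1 + n)) (F (2 + n))) (+-mono-≤-< (F-pos n) (n<F[2+n] n))

∣m+n-o+p∣≤∣m-o∣+∣n-p∣ : ∀ m n o p → ∣ m + n - o + p ∣ ≤ ∣ m - o ∣ + ∣ n - p ∣
∣m+n-o+p∣≤∣m-o∣+∣n-p∣ m n o p = begin
  ∣ m + n - o + p ∣                      ≤⟨ ∣-∣-triangle (m + n) (o + n) (o + p) ⟩
  ∣ m + n - o + n ∣ + ∣ o + n - o + p ∣  ≡⟨ cong₂ _+_ first (∣m+n-m+o∣≡∣n-o∣ o n p) ⟩
  ∣ m - o ∣ + ∣ n - p ∣                  ∎
  where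
  open ≤-Reasoning
  first : ∣ m + n - o + n ∣ ≡ ∣ m - o ∣
  first = trans (cong₂ ∣_-_∣ (+-comm m n) (+-comm o n)) (∣m+n-m+o∣≡∣n-o∣ n m o)

m≤n<m+o⇒∣m-n∣<o : ∀ {m n o} → m ≤ n → n < m + o → ∣ m - n ∣ < o
m≤n<m+o⇒∣m-n∣<o {m} {n} {o} m≤n n<m+o =
  subst (_< o) (sym (m≤n⇒∣m-n∣≡n∸m m≤n))
    (+-cancelˡ-< m (n ∸ m) o (subst (_< m + o) (sym (m+[n∸m]≡n m≤n)) n<m+o))

nearest-multiple-unique : ∀ {a a′ b c d e} →
  ∣ a * c - b ∣ < d → ∣ a′ * c - b ∣ < e → d + e ≤ c → a ≡ a′
nearest-multiple-unique {a} {a′} {b} {c} {d} {e} near near′ d+e≤c =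
  ∣m-n∣≡0⇒m≡n (n<1⇒n≡0 (*-cancelʳ-< c ∣ a - a′ ∣ 1 (begin-strict
    ∣ a - a′ ∣ * c                  ≡⟨ *-distribʳ-∣-∣ c a a′ ⟩
    ∣ a * c - a′ * c ∣              ≤⟨ ∣-∣-triangle (a * c) b (a′ * c) ⟩
    ∣ a * c - b ∣ + ∣ b - a′ * c ∣  <⟨ +-mono-< near (subst (_< e) (∣-∣-comm (a′ * c) b) near′) ⟩
    d + e                           ≤⟨ d+e≤c ⟩
    c                               ≡⟨ *-identityˡ c ⟨
    1 * c                           ∎)))
  where open ≤-Reasoning

-- a ─ c ≐ b ─ d says that a − c = b − d as integers.
record _─_≐_─_ (a c b d : ℕ) : Set where
  constructor diff
  field cross : a + d ≡ c + b
open _─_≐_─_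

≐-negate : ∀ {a b c d} → a ─ c ≐ b ─ d → c ─ a ≐ d ─ b
≐-negate (diff eq) = diff (sym eq)

≐-trans : ∀ {a b c d e f} → a ─ c ≐ b ─ d → b ─ d ≐ e ─ f → a ─ c ≐ e ─ f
≐-trans {a} {b} {c} {d} {e} {f} (diff ad≡cb) (diff bf≡de) =
  diff (+-cancelʳ-≡ (b + d) (a + f) (c + e) (begin
    a + f + (b + d)  ≡⟨ regroup a f b d ⟩
    a + d + (b + f)  ≡⟨ cong₂ _+_ ad≡cb bf≡de ⟩
    c + b + (d + e)  ≡⟨ regroup′ c b d e ⟩
    c + e + (b + d)  ∎))
  where
  open ≡-Reasoning
  regroup : ∀ a f b d → a + f + (b + d) ≡ a + d + (b + f)
  regroup = solve-∀
  regroup′ : ∀ c b d e → c + b + (d + e) ≡ c + e + (b + d)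
  regroup′ = solve-∀

≐⇒∣-∣≡ : ∀ {a b c d} → a ─ c ≐ b ─ d → ∣ a - c ∣ ≡ ∣ b - d ∣
≐⇒∣-∣≡ {a} {b} {c} {d} (diff eq) = begin
  ∣ a - c ∣          ≡⟨ ∣m+n-m+o∣≡∣n-o∣ d a c ⟨
  ∣ d + a - d + c ∣  ≡⟨ cong₂ ∣_-_∣ (trans (+-comm d a) eq) (+-comm d c) ⟩
  ∣ c + b - c + d ∣  ≡⟨ ∣m+n-m+o∣≡∣n-o∣ c b d ⟩
  ∣ b - d ∣          ∎
  where open ≡-Reasoning

-- Solutions of the Fibonacci recurrence

FibLike : (ℕ → ℕ) → Set
FibLike G = ∀ j → G (suc (suc j)) ≡ G (suc j) + G j

record Alternating (P Q : ℕ → ℕ) : Set where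
  constructor alternating
  field flip : ∀ j → P (suc j) ─ Q (suc j) ≐ Q j ─ P j
open Alternating

alternating-∣-∣ : ∀ {P Q} → Alternating P Q → ∀ j → ∣ P j - Q j ∣ ≡ ∣ P 0 - Q 0 ∣
alternating-∣-∣ alt zero = refl
alternating-∣-∣ {P} {Q} alt (suc j) = begin
  ∣ P (suc j) - Q (suc j) ∣  ≡⟨ ≐⇒∣-∣≡ (flip alt j) ⟩
  ∣ Q j - P j ∣              ≡⟨ ∣-∣-comm (Q j) (P j) ⟩
  ∣ P j - Q j ∣              ≡⟨ alternating-∣-∣ alt j ⟩
  ∣ P 0 - Q 0 ∣              ∎
  where open ≡-Reasoning

alternating-even : ∀ {P Q} → Alternating P Q → ∀ t → P (2 * t) ─ Q (2 * t) ≐ P 0 ─ Q 0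
alternating-even {P} {Q} alt zero = diff (+-comm (P 0) (Q 0))
alternating-even alt (suc t) rewrite *-suc 2 t =
  ≐-trans (flip alt (suc (2 * t))) (≐-trans (≐-negate (flip alt (2 * t))) (alternating-even alt t))

casoratian-alternating : ∀ {G H} → FibLike G → FibLike H →
  Alternating (λ j → G (suc j) * H j) (λ j → G j * H (suc j))
casoratian-alternating {G} {H} G-rec H-rec = alternating λ j → diff (begin
  G (2 + j) * H (1 + j) + G (1 + j) * H j
    ≡⟨ cong (λ g → g * H (1 + j) + G (1 + j) * H j) (G-rec j) ⟩
  (G (1 + j) + G j) * H (1 + j) + G (1 + j) * H j
    ≡⟨ regroup (G (1 + j)) (G j) (H (1 + j)) (H j) ⟩
  G (1 + j) * (H (1 + j) + H j) + G j * H (1 + j)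
    ≡⟨ cong (λ h → G (1 + j) * h + G j * H (1 + j)) (H-rec j) ⟨
  G (1 + j) * H (2 + j) + G j * H (1 + j)
    ∎)
  where
  open ≡-Reasoning
  regroup : ∀ a b c d → (a + b) * c + a * d ≡ a * (c + d) + b * c
  regroup = solve-∀

dOcagne : ∀ {i M} → i ≤ M → ∣ F (suc i) * F M - F i * F (suc M) ∣ ≡ F (M ∸ i)
dOcagne {i} {M} i≤M =
  subst (λ L → ∣ F (suc i) * F L - F i * F (suc L) ∣ ≡ F K) (m+[n∸m]≡n i≤M) (begin
    ∣ F (suc i) * F (i + K) - F i * F (suc i + K) ∣
      ≡⟨ alternating-∣-∣ (casoratian-alternating {F} {λ j → F (j + K)} (λ _ → refl) (λ _ → refl))
                         i ⟩
    ∣ 1 * F K - 0 ∣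
      ≡⟨ ∣-∣-identityʳ (1 * F K) ⟩
    1 * F K
      ≡⟨ *-identityˡ (F K) ⟩
    F K
      ∎)
  where
  open ≡-Reasoning
  K = M ∸ i

-- c² − cd − d² = 1, so c/d lies just above φ; F (1 + 2t) / F (2t) are such pairs.
CassiniPair : ℕ → ℕ → Set
CassiniPair c d = c * c ≡ d * (c + d) + 1

cassini-even : ∀ t → CassiniPair (F (suc (2 * t))) (F (2 * t))
cassini-even t = trans (sym (+-identityʳ _))
  (cross (alternating-even (casoratian-alternating {F} {λ j → F (suc j)} (λ _ → refl) (λ _ → refl)) t))

-- The shift of a Zeckendorf sum

All≤sum : ∀ S → All (_≤ sum S) S
All≤sum []      = []
All≤sum (i ∷ S) = m≤m+n i (sum S) ∷ All.map (λ j≤ → ≤-trans j≤ (m≤n+m (sum S) i)) (All≤sum S)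

complementSum : ℕ → List ℕ → ℕ
complementSum M S = sum (map (λ i → F (M ∸ i)) S)

shiftSum-defect≤ : ∀ {M} S → All (_≤ M) S →
  ∣ shiftSum S * F M - sum (map F S) * F (suc M) ∣ ≤ complementSum M S
shiftSum-defect≤ [] [] = z≤n
shiftSum-defect≤ {M} (i ∷ S) (i≤M ∷ S≤M) = begin
  ∣ (F (suc i) + shiftSum S) * F M - (F i + x) * F (suc M) ∣
    ≡⟨ cong₂ ∣_-_∣ (*-distribʳ-+ (F M) (F (suc i)) (shiftSum S))
                   (*-distribʳ-+ (F (suc M)) (F i) x) ⟩
  ∣ F (suc i) * F M + shiftSum S * F M - F i * F (suc M) + x * F (suc M) ∣
    ≤⟨ ∣m+n-o+p∣≤∣m-o∣+∣n-p∣ (F (suc i) * F M) (shiftSum S * F M)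
                             (F i * F (suc M)) (x * F (suc M)) ⟩
  ∣ F (suc i) * F M - F i * F (suc M) ∣ + ∣ shiftSum S * F M - x * F (suc M) ∣
    ≤⟨ +-mono-≤ (≤-reflexive (dOcagne i≤M)) (shiftSum-defect≤ S S≤M) ⟩
  F (M ∸ i) + complementSum M S
    ∎
  where
  open ≤-Reasoning
  x = sum (map F S)

F-∸-step : ∀ {l i N} → 2 + l ≤ i → i ≤ N → F (2 + N ∸ i) + F (1 + N ∸ i) ≤ F (1 + N ∸ l)
F-∸-step {l} {i} {N} 2+l≤i i≤N = begin
  F (2 + N ∸ i) + F (1 + N ∸ i)
    ≡⟨ cong₂ _+_ (cong F (+-∸-assoc 2 i≤N)) (cong F (+-∸-assoc 1 i≤N)) ⟩
  F (2 + (N ∸ i)) + F (1 + (N ∸ i))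
    ≡⟨ cong F (+-∸-assoc 3 i≤N) ⟨
  F (3 + N ∸ i)
    ≤⟨ F-mono (∸-monoʳ-≤ (3 + N) 2+l≤i) ⟩
  F (1 + N ∸ l)
    ∎
  where open ≤-Reasoning

complementSum-telescope : ∀ {N i S} → ZeckSet (i ∷ S) → All (_≤ N) (i ∷ S) →
  complementSum (2 + N) (i ∷ S) + F (1 + N ∸ i) ≤ F (1 + N)
complementSum-telescope {N} {i} (one 2≤i) (i≤N ∷ []) = begin
  F (2 + N ∸ i) + 0 + F (1 + N ∸ i)  ≡⟨ cong (_+ F (1 + N ∸ i)) (+-identityʳ (F (2 + N ∸ i))) ⟩
  F (2 + N ∸ i) + F (1 + N ∸ i)      ≤⟨ F-∸-step 2≤i i≤N ⟩
  F (1 + N)                          ∎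
  where open ≤-Reasoning
complementSum-telescope {N} {i} (cons {j = j} {is} 2+j≤i zs) (i≤N ∷ j∷is≤N) = begin
  F (2 + N ∸ i) + C + F (1 + N ∸ i)    ≡⟨ cong (_+ F (1 + N ∸ i)) (+-comm (F (2 + N ∸ i)) C) ⟩
  C + F (2 + N ∸ i) + F (1 + N ∸ i)    ≡⟨ +-assoc C (F (2 + N ∸ i)) (F (1 + N ∸ i)) ⟩
  C + (F (2 + N ∸ i) + F (1 + N ∸ i))  ≤⟨ +-monoʳ-≤ C (F-∸-step 2+j≤i i≤N) ⟩
  C + F (1 + N ∸ j)                    ≤⟨ complementSum-telescope zs j∷is≤N ⟩
  F (1 + N)                            ∎
  where
  open ≤-Reasoning
  C = complementSum (2 + N) (j ∷ is)

complementSum< : ∀ {N S} → ZeckSet S → All (_≤ N) S → complementSum (2 + N) S < F (1 + N)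
complementSum< {N} {[]}    _  _              = F-pos N
complementSum< {N} {i ∷ S} zs S≤N@(i≤N ∷ _) =
  <-≤-trans (m<m+n _ (subst (λ r → 0 < F r) (sym (+-∸-assoc 1 i≤N)) (F-pos (N ∸ i))))
            (complementSum-telescope zs S≤N)

shiftSum-approx : ∀ {N S} → ZeckSet S → All (_≤ N) S →
  ∣ shiftSum S * F (2 + N) - sum (map F S) * F (3 + N) ∣ < F (1 + N)
shiftSum-approx {N} {S} zs S≤N = ≤-<-trans
  (shiftSum-defect≤ S (All.map (λ i≤N → ≤-trans i≤N (m≤n+m N 2)) S≤N))
  (complementSum< zs S≤N)

-- Rational approximation of φ

m+n≡o+p⇒o≤m⇒n≤p : ∀ {m n o p} → m + n ≡ o + p → o ≤ m → n ≤ p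
m+n≡o+p⇒o≤m⇒n≤p {m} {n} {o} {p} eq o≤m =
  +-cancelˡ-≤ o n p (≤-trans (+-monoˡ-≤ n o≤m) (≤-reflexive eq))

φ≤-identity : ∀ n k u → u + k ≡ 2 * n → u * u + 4 * (k * k + n * k) ≡ 5 * (k * k) + 4 * (n * n)
φ≤-identity n k u u+k≡2n = begin
  u * u + 4 * (k * k + n * k)            ≡⟨ expand u k n ⟩
  u * u + 4 * (k * k) + 2 * k * (2 * n)  ≡⟨ cong (λ v → u * u + 4 * (k * k) + 2 * k * v) u+k≡2n ⟨
  u * u + 4 * (k * k) + 2 * k * (u + k)  ≡⟨ complete u k ⟩
  5 * (k * k) + (u + k) * (u + k)        ≡⟨ cong (λ v → 5 * (k * k) + v * v) u+k≡2n ⟩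
  5 * (k * k) + (2 * n) * (2 * n)        ≡⟨ square-double k n ⟩
  5 * (k * k) + 4 * (n * n)              ∎
  where
  open ≡-Reasoning
  expand : ∀ u k n → u * u + 4 * (k * k + n * k) ≡ u * u + 4 * (k * k) + 2 * k * (2 * n)
  expand = solve-∀
  complete : ∀ u k → u * u + 4 * (k * k) + 2 * k * (u + k) ≡ 5 * (k * k) + (u + k) * (u + k)
  complete = solve-∀
  square-double : ∀ k n → 5 * (k * k) + (2 * n) * (2 * n) ≡ 5 * (k * k) + 4 * (n * n)
  square-double = solve-∀

quadratic⇒≤ : ∀ {k n} → k * k + n * k ≤ n * n → k ≤ n
quadratic⇒≤ {k} {n} hk =
  ≮⇒≥ λ n<k → <⇒≱ (*-mono-< n<k n<k) (≤-trans (m≤m+n (k * k) (n * k)) hk)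

φ≤⇒quadratic : ∀ {k n} → k φ≤ n → k * k + n * k ≤ n * n
φ≤⇒quadratic {k} {n} (k≤2n , 5kk≤uu) =
  *-cancelˡ-≤ 4 (m+n≡o+p⇒o≤m⇒n≤p (φ≤-identity n k (2 * n ∸ k) (m∸n+n≡m k≤2n)) 5kk≤uu)

quadratic⇒φ≤ : ∀ {k n} → k * k + n * k ≤ n * n → k φ≤ n
quadratic⇒φ≤ {k} {n} hk = k≤2n , m+n≡o+p⇒o≤m⇒n≤p eq (*-monoʳ-≤ 4 hk)
  where
  k≤2n : k ≤ 2 * n
  k≤2n = ≤-trans (quadratic⇒≤ hk) (m≤m+n n (n + 0))
  u = 2 * n ∸ k
  eq : 4 * (n * n) + 5 * (k * k) ≡ 4 * (k * k + n * k) + u * u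
  eq = trans (+-comm (4 * (n * n)) _)
         (trans (sym (φ≤-identity n k u (m∸n+n≡m k≤2n))) (+-comm (u * u) _))

¬φ≤⇒quadratic : ∀ {k n} → ¬ (k φ≤ n) → n * n < k * k + n * k
¬φ≤⇒quadratic {k} {n} ¬kφ≤n = ≰⇒> (λ hk → ¬kφ≤n (quadratic⇒φ≤ {k} {n} hk))

golden-form-scaled : ∀ a b d → (a * a + b * a) * (d * d) ≡ (a * d) * (a * d) + (b * d) * (a * d)
golden-form-scaled = solve-∀

square-scaled : ∀ b d → (b * b) * (d * d) ≡ (b * d) * (b * d)
square-scaled = solve-∀

cassini-scaled : ∀ {c d} k → CassiniPair c d →
  (k * c) * (k * c) ≡ (k * c) * (k * d) + (k * d) * (k * d) + k * k
cassini-scaled {c} {d} k cas = begin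
  (k * c) * (k * c)                              ≡⟨ gather k c ⟩
  (k * k) * (c * c)                              ≡⟨ cong ((k * k) *_) cas ⟩
  (k * k) * (d * (c + d) + 1)                    ≡⟨ spread k c d ⟩
  (k * c) * (k * d) + (k * d) * (k * d) + k * k  ∎
  where
  open ≡-Reasoning
  gather : ∀ k c → (k * c) * (k * c) ≡ (k * k) * (c * c)
  gather = solve-∀
  spread : ∀ k c d → (k * k) * (d * (c + d) + 1) ≡ (k * c) * (k * d) + (k * d) * (k * d) + k * k
  spread = solve-∀

-- With t = x − w: (x² − xz) − (w² − wz) = t (x + w − z) ≥ t x.
quadratic-gap : ∀ {w t x z} → z ≤ w → w + t ≡ x → w * w + t * x + x * z ≤ x * x + w * z
quadratic-gap {w} {t} {_} {z} z≤w refl with m≤n⇒∃[o]m+o≡n z≤w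
... | s , refl = ≤-trans (m≤m+n _ (t * s)) (≤-reflexive (expand z s t))
  where
  expand : ∀ z s t → (z + s) * (z + s) + t * (z + s + t) + (z + s + t) * z + t * s
                   ≡ (z + s + t) * (z + s + t) + (z + s) * z
  expand = solve-∀

-- If n·d < k·c, quadratic-gap at z = k·d bounds (k·c − n·d)·k·c by k², yet k·c > k².
≥φ⇒≥convergent : ∀ {n k c d} → k * k + n * k ≤ n * n → CassiniPair c d → k < c → k * c ≤ n * d
≥φ⇒≥convergent {k = zero} _ _ _ = z≤n
≥φ⇒≥convergent {n} {k@(suc _)} {c} {d} hk cas k<c =
  ≮⇒≥ λ w<x → <⇒≱ (*-monoʳ-< k k<c) (x≤kk w<x)
  where
  x = k * c
  w = n * d
  z = k * d
  zz+wz≤ww : z * z + w * z ≤ w * w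
  zz+wz≤ww = subst₂ _≤_ (golden-form-scaled k n d) (square-scaled n d) (*-monoˡ-≤ (d * d) hk)
  x≤kk : w < x → x ≤ k * k
  x≤kk w<x = ≤-trans (m≤n*m x t {{>-nonZero (m<n⇒0<n∸m w<x)}}) tx≤kk
    where
    open ≤-Reasoning
    t = x ∸ w
    swap : ∀ a b e → a + b + e ≡ a + e + b
    swap = solve-∀
    regroup : ∀ a b e f → a + b + e + f ≡ a + e + (b + f)
    regroup = solve-∀
    rotate : ∀ a e f → a + e + f ≡ f + a + e
    rotate = solve-∀
    tx≤kk : t * x ≤ k * k
    tx≤kk = +-cancelˡ-≤ (w * w + x * z) (t * x) (k * k) (begin
      w * w + x * z + t * x
        ≡⟨ swap (w * w) (x * z) (t * x) ⟩
      w * w + t * x + x * z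
        ≤⟨ quadratic-gap (*-monoˡ-≤ d (quadratic⇒≤ {k} {n} hk)) (m+[n∸m]≡n (<⇒≤ w<x)) ⟩
      x * x + w * z
        ≡⟨ cong (_+ w * z) (cassini-scaled {c} {d} k cas) ⟩
      x * z + z * z + k * k + w * z
        ≡⟨ regroup (x * z) (z * z) (k * k) (w * z) ⟩
      x * z + k * k + (z * z + w * z)
        ≤⟨ +-monoʳ-≤ (x * z + k * k) zz+wz≤ww ⟩
      x * z + k * k + w * w
        ≡⟨ rotate (x * z) (k * k) (w * w) ⟩
      w * w + x * z + k * k
        ∎)

<φ⇒<convergent : ∀ {n q c d} .{{_ : NonZero d}} →
  n * n < q * q + n * q → CassiniPair c d → d ≤ c → n * d < q * c
<φ⇒<convergent {n} {q} {c} {d} hn cas d≤c = ≰⇒> λ w≤x → <-irrefl refl (begin-strict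
  z * z + x * z + w * z
    ≤⟨ m≤m+n _ (q * q + t * x) ⟩
  z * z + x * z + w * z + (q * q + t * x)
    ≡⟨ regroup (z * z) (x * z) (w * z) (q * q) (t * x) ⟩
  w * z + z * z + q * q + t * x + x * z
    ≡⟨ cong (λ v → v + t * x + x * z) (cassini-scaled {c} {d} q cas) ⟨
  w * w + t * x + x * z
    ≤⟨ quadratic-gap (*-monoʳ-≤ q d≤c) (m+[n∸m]≡n w≤x) ⟩
  x * x + w * z
    <⟨ +-monoˡ-< (w * z) xx<zz+xz ⟩
  z * z + x * z + w * z
    ∎)
  where
  open ≤-Reasoning
  w = q * c
  x = n * d
  z = q * d
  t = x ∸ w
  xx<zz+xz : x * x < z * z + x * z
  xx<zz+xz =
    subst₂ _<_ (square-scaled n d) (golden-form-scaled q n d) (*-monoˡ-< (d * d) {{m*n≢0 d d}} hn)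
  regroup : ∀ a b e f g → a + b + e + (f + g) ≡ e + a + f + g + b
  regroup = solve-∀

floor-bracket : ∀ {n k c d} .{{_ : NonZero d}} →
  IsFloorDivφ n k → CassiniPair c d → d ≤ c → k < c → ∣ k * c - (n + 1) * d ∣ < c + d
floor-bracket {n} {k} {c} {d} (kφ≤n , ¬k+1φ≤n) cas d≤c k<c = m≤n<m+o⇒∣m-n∣<o lower upper
  where
  open ≤-Reasoning
  lower : k * c ≤ (n + 1) * d
  lower = ≤-trans (≥φ⇒≥convergent {n} {k} {c} {d} (φ≤⇒quadratic {k} {n} kφ≤n) cas k<c)
                  (*-monoˡ-≤ d (m≤m+n n 1))
  upper : (n + 1) * d < k * c + (c + d)
  upper = begin-strict
    (n + 1) * d      ≡⟨ *-distribʳ-+ d n 1 ⟩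
    n * d + 1 * d    ≡⟨ cong (n * d +_) (*-identityˡ d) ⟩
    n * d + d        <⟨ +-monoˡ-< d (<φ⇒<convergent {n} {suc k} {c} {d}
                                       (¬φ≤⇒quadratic {suc k} {n} ¬k+1φ≤n) cas d≤c) ⟩
    c + k * c + d    ≡⟨ cong (_+ d) (+-comm c (k * c)) ⟩
    k * c + c + d    ≡⟨ +-assoc (k * c) c d ⟩
    k * c + (c + d)  ∎

-- The claimed shift

fibCombination : ℕ → ℕ → ℕ → ℕ
fibCombination p q j = p * F (suc j) + F j * q

fibCombination-fibLike : ∀ p q → FibLike (fibCombination p q)
fibCombination-fibLike p q j = distribute p q (F (2 + j)) (F (1 + j)) (F j)
  where
  distribute : ∀ p q a b e → p * (a + b) + (b + e) * q ≡ (p * a + b * q) + (p * b + e * q)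
  distribute = solve-∀

fibCombination-casoratian : ∀ p q j K →
  ∣ fibCombination p q (suc j) * F (suc j + K) - fibCombination p q j * F (2 + j + K) ∣
    ≡ ∣ q * F (suc K) - p * F K ∣
fibCombination-casoratian p q j K = begin
  ∣ fibCombination p q (suc j) * F (suc j + K) - fibCombination p q j * F (2 + j + K) ∣
    ≡⟨ alternating-∣-∣ (casoratian-alternating {fibCombination p q} {λ i → F (suc i + K)}
                         (fibCombination-fibLike p q) (λ _ → refl)) j ⟩
  ∣ (p * 1 + 1 * q) * F (suc K) - (p * 1 + 0 * q) * (F (suc K) + F K) ∣
    ≡⟨ cong₂ ∣_-_∣ (initial p q (F (suc K))) (initial′ p q (F (suc K)) (F K)) ⟩
  ∣ p * F (suc K) + q * F (suc K) - p * F (suc K) + p * F K ∣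
    ≡⟨ ∣m+n-m+o∣≡∣n-o∣ (p * F (suc K)) (q * F (suc K)) (p * F K) ⟩
  ∣ q * F (suc K) - p * F K ∣
    ∎
  where
  open ≡-Reasoning
  initial : ∀ p q a → (p * 1 + 1 * q) * a ≡ p * a + q * a
  initial = solve-∀
  initial′ : ∀ p q a b → (p * 1 + 0 * q) * (a + b) ≡ p * a + p * b
  initial′ = solve-∀

fibCombination-approx : ∀ {n k t} → IsFloorDivφ n k → k ≤ t → ∀ j → let K = 2 * suc t in
  ∣ fibCombination (n + 1) k (suc j) * F (suc j + K) - fibCombination (n + 1) k j * F (2 + j + K) ∣
    < F (2 + K)
fibCombination-approx {n} {k} {t} floor k≤t j = begin-strict
  ∣ fibCombination (n + 1) k (suc j) * F (suc j + K) - fibCombination (n + 1) k j * F (2 + j + K) ∣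
    ≡⟨ fibCombination-casoratian (n + 1) k j K ⟩
  ∣ k * F (suc K) - (n + 1) * F K ∣
    <⟨ floor-bracket {n} {k} {{F[K]≢0}} floor (cassini-even (suc t)) (F-≤-suc K) k<F[1+K] ⟩
  F (2 + K)
    ∎
  where
  open ≤-Reasoning
  K = 2 * suc t
  F[K]≢0 : NonZero (F K)
  F[K]≢0 = >-nonZero (F-mono {1} {K} (s≤s z≤n))
  k<F[1+K] : k < F (suc K)
  k<F[1+K] = <-≤-trans (n<F[2+n] k) (F-mono (s≤s (s≤s (≤-trans k≤t (m≤m+n t _)))))

lemma4 : (n m k : ℕ) → 3 < m → IsFloorDivφ n k →
    (S : List ℕ) → IsZeckendorf S ((n + 1) * F m + F (m ∸ 1) * k) →
    shiftSum S ≡ (n + 1) * F (suc m) + F m * k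
lemma4 n m@(suc (suc (suc (suc l)))) k (s≤s (s≤s (s≤s (s≤s _)))) floor S (zs , sx) =
  nearest-multiple-unique {b = x * F (3 + N)} {c = F (2 + N)} shift-near claim-near ≤-refl
  where
  x = sum (map F S)
  -- t ≥ k makes F (suc K) exceed k, and t ≥ sum S bounds every index in S.
  t = k + sum S
  K = 2 * suc t
  -- 2 + N = m + K is the index M of the argument.
  N = 2 + l + K
  s≤N : sum S ≤ N
  s≤N = ≤-trans (m≤n+m (sum S) k)
          (≤-trans (≤-trans (n≤1+n t) (m≤m+n (suc t) _)) (m≤n+m K (2 + l)))
  shift-near : ∣ shiftSum S * F (2 + N) - x * F (3 + N) ∣ < F (1 + N)
  shift-near = shiftSum-approx zs (All.map (λ i≤s → ≤-trans i≤s s≤N) (All≤sum S))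
  claim-near : ∣ fibCombination (n + 1) k m * F (2 + N) - x * F (3 + N) ∣ < F N
  claim-near = subst (λ y → ∣ fibCombination (n + 1) k m * F (2 + N) - y * F (3 + N) ∣ < F N) (sym sx)
    (<-≤-trans (fibCombination-approx {n} floor (m≤m+n k (sum S)) (3 + l))
               (F-mono (s≤s (s≤s (m≤n+m K l)))))
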